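{- Let $\mathscr{F}$ be a forest of linear $k$-uniform hypergraphs and let $J$ be an induced subhypergraph of $\bigcup\mathscr{F}$. If $J$ is $(e,v)$-inseparable, then there is some $F\in\mathscr{F}$ such that $J$ is an induced subhypergraph of $F$.
   Context: A hypergraph is linear if any two distinct edges share at most one vertex. A set $\mathscr{F}$ of linear hypergraphs is a forest if there is an enumeration $\mathscr{F}=\{F_1,\dots,F_{|\mathscr{F}|}\}$ such that for every $j\in[2,|\mathscr{F}|]$ the set $V(F_j)\cap\bigcup_{i<j}V(F_i)$ is either empty, or a single vertex, or an edge belonging both to $E(F_j)$ and to $\bigcup_{i<j}E(F_i)$; $\bigcup\mathscr{F}$ is the hypergraph with vertex set $\bigcup_iV(F_i)$ and edge set $\bigcup_iE(F_i)$. A hypergraph is connected if for every partition $V=X\cup Y$ with $X,Y\neq\emptyset$ some edge meets both $X$ and $Y$. A linear $k$-uniform hypergraph $F$ is $(e,v)$-inseparable if (a) $F$ is connected and has at least two edges, (b) for every $z\subseteq V(F)$ with $|z|<k$ such that no two vertices of $z$ lie in a common edge, the hypergraph $F-z$ (delete the vertices of $z$ and all edges meeting them) is connected, and (c) for every edge $e\in E(F)$ the hypergraph $F-e$ obtained by deleting all vertices of $e$ (and all edges meeting them) is connected. -}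

module Defs where

open import Level using (0ℓ)
open import Data.Nat using (ℕ; _≤_; _<_)
open import Data.Fin using (Fin)
open import Data.Fin.Subset using (Subset; ⊥; _∈_; _⊆_; _∩_; _∪_; _─_; ∣_∣; Nonempty; Empty)
open import Data.List using (List; []; _∷_)
import Data.List.Membership.Propositional as L
open import Data.List.Relation.Binary.Permutation.Propositional using (_↭_)
open import Data.Product using (Σ; ∃; _×_)
open import Data.Sum using (_⊎_)
open import Relation.Nullary using (¬_)
open import Relation.Binary.PropositionalEquality using (_≡_; _≢_)
open import Function.Bundles using (_⇔_)

record Hypergraph (n : ℕ) : Set₁ where
  constructor hg
  field
    V : Subset n
    E : Subset n → Set
open Hypergraph public

module _ {n : ℕ} where

  EdgesInV : Hypergraph n → Set
  EdgesInV H = ∀ e → E H e → e ⊆ V H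

  Uniform : ℕ → Hypergraph n → Set
  Uniform k H = ∀ e → E H e → ∣ e ∣ ≡ k

  Linear : Hypergraph n → Set
  Linear H = ∀ e f → E H e → E H f → e ≢ f → ∣ e ∩ f ∣ ≤ 1

  LinearUniform : ℕ → Hypergraph n → Set
  LinearUniform k H = EdgesInV H × Uniform k H × Linear H

  Connected : Hypergraph n → Set
  Connected H = ∀ X → X ⊆ V H → Nonempty X → Nonempty (V H ─ X) →
    ∃ λ e → E H e × Nonempty (e ∩ X) × Nonempty (e ∩ (V H ─ X))

  delete : Hypergraph n → Subset n → Hypergraph n
  delete H z = hg (V H ─ z) (λ e → E H e × Empty (e ∩ z))

  AtLeastTwoEdges : Hypergraph n → Set
  AtLeastTwoEdges H = ∃ λ e → ∃ λ f → E H e × E H f × e ≢ f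

  Independent : Hypergraph n → Subset n → Set
  Independent H z = ∀ x y → x ∈ z → y ∈ z → x ≢ y →
    ¬ (∃ λ e → E H e × x ∈ e × y ∈ e)

  Inseparable : ℕ → Hypergraph n → Set
  Inseparable k F =
    LinearUniform k F
    × (Connected F × AtLeastTwoEdges F)
    × (∀ z → z ⊆ V F → ∣ z ∣ < k → Independent F z → Connected (delete F z))
    × (∀ e → E F e → Connected (delete F e))

  ⋃V : List (Hypergraph n) → Subset n
  ⋃V []       = ⊥
  ⋃V (F ∷ Fs) = V F ∪ ⋃V Fs

  ⋃E : List (Hypergraph n) → Subset n → Set
  ⋃E []       e = Bot
    where open import Data.Empty using () renaming (⊥ to Bot)
  ⋃E (F ∷ Fs) e = E F e ⊎ ⋃E Fs e

  ⋃ : List (Hypergraph n) → Hypergraph n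
  ⋃ Fs = hg (⋃V Fs) (⋃E Fs)

  Attaches : Subset n → (Subset n → Set) → Hypergraph n → Set
  Attaches PV PE F =
    Empty (V F ∩ PV) ⊎ (∣ V F ∩ PV ∣ ≡ 1 ⊎ (E F (V F ∩ PV) × PE (V F ∩ PV)))

  -- the list, in the given order, is a valid forest enumeration;
  -- PV / PE accumulate vertices / edges of the earlier members
  OrderedForestFrom : Subset n → (Subset n → Set) → List (Hypergraph n) → Set₁
  OrderedForestFrom PV PE []       = Lift-⊤
    where open import Data.Unit.Polymorphic using () renaming (⊤ to Lift-⊤)
  OrderedForestFrom PV PE (F ∷ Fs) =
    Lift₁ (Attaches PV PE F) × OrderedForestFrom (PV ∪ V F) (λ e → PE e ⊎ E F e) Fs
    where open import Level using () renaming (Lift to Lift′)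
          Lift₁ : Set → Set₁
          Lift₁ A = Lift′ _ A

  IsForest : ℕ → List (Hypergraph n) → Set₁
  IsForest k Fs =
    (∀ F → F L.∈ Fs → LinearUniform k F)
    × ∃ λ Gs → Gs ↭ Fs × OrderedForestFrom ⊥ (λ _ → Bot) Gs
    where open import Data.Empty using () renaming (⊥ to Bot)

  Induced : Hypergraph n → Hypergraph n → Set
  Induced J H = V J ⊆ V H × (∀ e → E J e ⇔ (E H e × e ⊆ V J))

{-# OPTIONS --safe #-}
-- Walk along an enumeration witnessing the forest property, keeping the union P of the members
-- seen so far; the next member F meets P in S = V F ∩ V P, which is empty, one vertex, or an edge
-- of both. If an inseparable J induced in P ∪ F had vertices outside V P and outside V F, deleting
-- S ∩ V J would disconnect it. But S ∩ V J is either the edge S itself, or an independent set of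
-- fewer than k vertices: it has at most one vertex, or it is a proper part of the edge S, which by
-- linearity shares at most one vertex with any other edge. So V J lies in V P or in V F, and J
-- stays induced there, because an edge of the other side inside it is a k-subset of S, hence S
-- itself (k ≥ 2, since inseparable J has an edge crossing a partition).
module Submission where

open import Defs
open import Data.Nat using (ℕ; _≤_; _<_; z≤n; s≤s)
open import Data.Nat.Properties using (≤-trans; ≤-reflexive; <-≤-trans; ≤-<-trans; <⇒≢; <⇒≱)
open import Data.Fin using (Fin)
open import Data.Fin.Subset
  using (Subset; _∈_; _∉_; _⊆_; _⊈_; _⊂_; _∩_; _∪_; _─_; ∣_∣; ⁅_⁆; Nonempty)
open import Data.Fin.Subset.Properties
open import Data.Vec using (_∷_)
open import Data.Vec.Base using (there)
open import Data.Vec.Properties using (≡-dec)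
import Data.Bool as Bool
open import Data.List using (List; []; _∷_)
import Data.List.Membership.Propositional as L
open import Data.List.Relation.Unary.Any using (here; there)
open import Data.List.Relation.Binary.Permutation.Propositional using (_↭_; ↭-sym)
import Data.List.Relation.Binary.Permutation.Propositional as ↭
open import Data.List.Relation.Binary.Permutation.Propositional.Properties using (∈-resp-↭)
open import Data.Product using (∃; _×_; _,_; proj₁; proj₂)
open import Data.Product.Function.NonDependent.Propositional using (_×-⇔_)
open import Data.Sum using (_⊎_; inj₁; inj₂; [_,_]; map₂; assocʳ; assocˡ)
open import Data.Sum.Function.Propositional using (_⊎-⇔_)
open import Data.Empty using (⊥-elim)
open import Function using (_∘_; id)
open import Function.Bundles using (_⇔_; mk⇔; Equivalence)
open import Function.Properties.Equivalence using ()
  renaming (refl to ⇔-refl; sym to ⇔-sym; trans to ⇔-trans)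
open import Level using (lift)
open import Relation.Nullary using (¬_; yes; no; contradiction)
open import Relation.Nullary.Decidable using (decidable-stable)
open import Relation.Binary.PropositionalEquality
  using (_≡_; _≢_; refl; sym; trans; cong; subst; module ≡-Reasoning)

open Equivalence using (to; from)

x∈p─q⇒x∉q : ∀ {n} {x : Fin n} (p q : Subset n) → x ∈ p ─ q → x ∉ q
x∈p─q⇒x∉q (_ ∷ p) (_ ∷ q) (there x∈p─q) (there x∈q) = x∈p─q⇒x∉q p q x∈p─q x∈q

module _ {n : ℕ} where

  variable
    k : ℕ
    x y : Fin n
    e p q s z X : Subset n
    F G H J P : Hypergraph n
    Fs Gs : List (Hypergraph n)

  ⊈-witness : ∀ (p q : Subset n) → p ⊈ q → ∃ λ x → x ∈ p × x ∉ q
  ⊈-witness p q p⊈q with nonempty? (p ─ q)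
  ... | yes (x , x∈p─q) = x , p─q⊆p p q x∈p─q , x∈p─q⇒x∉q p q x∈p─q
  ... | no  p─q-empty  = ⊥-elim (p⊈q p⊆q)
    where
      p⊆q : p ⊆ q
      p⊆q {x} x∈p = decidable-stable (x ∈? q) λ x∉q → p─q-empty (x , x∈p∧x∉q⇒x∈p─q x∈p x∉q)

  x∈p⇒0<∣p∣ : x ∈ p → 0 < ∣ p ∣
  x∈p⇒0<∣p∣ {x = x} {p = p} x∈p = ≤-trans (≤-reflexive (sym (∣⁅x⁆∣≡1 x))) (p⊆q⇒∣p∣≤∣q∣ ⁅x⁆⊆p)
    where
      ⁅x⁆⊆p : ⁅ x ⁆ ⊆ p
      ⁅x⁆⊆p y∈⁅x⁆ = subst (_∈ _) (sym (x∈⁅y⁆⇒x≡y x y∈⁅x⁆)) x∈p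

  x∈p∧y∈p∧x≢y⇒1<∣p∣ : x ∈ p → y ∈ p → x ≢ y → 1 < ∣ p ∣
  x∈p∧y∈p∧x≢y⇒1<∣p∣ x∈p y∈p x≢y =
    <-≤-trans (s≤s (x∈p⇒0<∣p∣ (x∈p∧x≢y⇒x∈p-y x∈p x≢y))) (x∈p⇒∣p-x∣<∣p∣ y∈p)

  p⊆q∧∣p∣≡∣q∣⇒p≡q : p ⊆ q → ∣ p ∣ ≡ ∣ q ∣ → p ≡ q
  p⊆q∧∣p∣≡∣q∣⇒p≡q {p = p} {q = q} p⊆q ∣p∣≡∣q∣ with q ⊆? p
  ... | yes q⊆p = ⊆-antisym p⊆q q⊆p
  ... | no  q⊈p = contradiction ∣p∣≡∣q∣ (<⇒≢ (p⊂q⇒∣p∣<∣q∣ (p⊆q , ⊈-witness q p q⊈p)))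

  ∣p∣≡∣q∣∧p≢q⇒p⊈q : ∣ p ∣ ≡ ∣ q ∣ → p ≢ q → p ⊈ q
  ∣p∣≡∣q∣∧p≢q⇒p⊈q ∣p∣≡∣q∣ p≢q p⊆q = p≢q (p⊆q∧∣p∣≡∣q∣⇒p≡q p⊆q ∣p∣≡∣q∣)

  p⊆q⇒p∩q≡p : p ⊆ q → p ∩ q ≡ p
  p⊆q⇒p∩q≡p {p = p} {q = q} p⊆q = ⊆-antisym (p∩q⊆p p q) (λ x∈p → x∈p∩q⁺ (x∈p , p⊆q x∈p))

  crossing-edge⇒1<∣e∣ : Nonempty (e ∩ X) → Nonempty (e ∩ (s ─ X)) → 1 < ∣ e ∣
  crossing-edge⇒1<∣e∣ {e = e} {X = X} {s = s} (x , x∈e∩X) (y , y∈e∩s─X) =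
    x∈p∧y∈p∧x≢y⇒1<∣p∣ (proj₁ (x∈p∩q⁻ e X x∈e∩X)) (proj₁ (x∈p∩q⁻ e (s ─ X) y∈e∩s─X)) x≢y
    where
      x≢y : x ≢ y
      x≢y refl = x∈p─q⇒x∉q s X (proj₂ (x∈p∩q⁻ e (s ─ X) y∈e∩s─X)) (proj₂ (x∈p∩q⁻ e X x∈e∩X))

  inseparable⇒1<k : Inseparable k J → 1 < k
  inseparable⇒1<k ((E⊆V , uniform , _) , (connected , e , f , J∋e , J∋f , e≢f) , _)
    with ⊈-witness e f (∣p∣≡∣q∣∧p≢q⇒p⊈q (trans (uniform e J∋e) (sym (uniform f J∋f))) e≢f)
       | ⊈-witness f e (∣p∣≡∣q∣∧p≢q⇒p⊈q (trans (uniform f J∋f) (sym (uniform e J∋e))) (e≢f ∘ sym))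
  ... | x , x∈e , _ | y , y∈f , y∉e
    with connected e (E⊆V e J∋e) (x , x∈e) (y , x∈p∧x∉q⇒x∈p─q (E⊆V f J∋f y∈f) y∉e)
  ... | g , J∋g , g-meets-e , g-meets-rest =
    subst (1 <_) (uniform g J∋g) (crossing-edge⇒1<∣e∣ g-meets-e g-meets-rest)

  independent-of-size≤1 : ∣ z ∣ ≤ 1 → Independent H z
  independent-of-size≤1 ∣z∣≤1 _ _ x∈z y∈z x≢y _ = <⇒≱ (x∈p∧y∈p∧x≢y⇒1<∣p∣ x∈z y∈z x≢y) ∣z∣≤1

  induced-restrict : Induced J H → V J ⊆ V G → (∀ e → E G e → E H e) →
    (∀ e → E H e → e ⊆ V J → E G e) → Induced J G
  induced-restrict {J = J} {H = H} {G = G} (_ , J⇔) VJ⊆VG G⊆H H⊆G =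
    VJ⊆VG , λ e → mk⇔ (restrict ∘ to (J⇔ e)) (λ (G∋e , e⊆VJ) → from (J⇔ e) (G⊆H e G∋e , e⊆VJ))
    where
      restrict : E H e × e ⊆ V J → E G e × e ⊆ V J
      restrict (H∋e , e⊆VJ) = H⊆G _ H∋e e⊆VJ , e⊆VJ

  independent-in-edge : Linear H → Induced J H → E H s → s ⊈ V J → z ⊆ s → Independent J z
  independent-in-edge {H = H} {s = s} lin (_ , J⇔) H∋s s⊈VJ z⊆s
    x y x∈z y∈z x≢y (e , J∋e , x∈e , y∈e) =
    <⇒≱ (x∈p∧y∈p∧x≢y⇒1<∣p∣ (x∈p∩q⁺ (x∈e , z⊆s x∈z)) (x∈p∩q⁺ (y∈e , z⊆s y∈z)) x≢y)
        (lin e s H∋e H∋s e≢s)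
    where
      H∋e : E H e
      H∋e = proj₁ (to (J⇔ e) J∋e)
      e≢s : e ≢ s
      e≢s refl = s⊈VJ (proj₂ (to (J⇔ e) J∋e))

  infixr 6 _∪ᴴ_
  _∪ᴴ_ : Hypergraph n → Hypergraph n → Hypergraph n
  G ∪ᴴ H = hg (V G ∪ V H) (λ e → E G e ⊎ E H e)

  ∅ᴴ : Hypergraph n
  ∅ᴴ = ⋃ []

  ∅ᴴ-linearUniform : LinearUniform k ∅ᴴ
  ∅ᴴ-linearUniform = (λ _ ()) , (λ _ ()) , (λ _ _ ())

  ¬induced-∅ᴴ : E J e → ¬ Induced J ∅ᴴ
  ¬induced-∅ᴴ J∋e (_ , J⇔) = proj₁ (to (J⇔ _) J∋e)

  infix 4 _≅_
  record _≅_ (G H : Hypergraph n) : Set where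
    constructor mk≅
    field
      V-≡ : V G ≡ V H
      E-⇔ : ∀ e → E G e ⇔ E H e

  ≅-refl : H ≅ H
  ≅-refl = mk≅ refl λ _ → ⇔-refl

  ≅-sym : G ≅ H → H ≅ G
  ≅-sym (mk≅ V-≡ E-⇔) = mk≅ (sym V-≡) (⇔-sym ∘ E-⇔)

  ≅-trans : F ≅ G → G ≅ H → F ≅ H
  ≅-trans (mk≅ V-≡₁ E-⇔₁) (mk≅ V-≡₂ E-⇔₂) = mk≅ (trans V-≡₁ V-≡₂) λ e → ⇔-trans (E-⇔₁ e) (E-⇔₂ e)

  ∪ᴴ-congˡ : G ≅ H → F ∪ᴴ G ≅ F ∪ᴴ H
  ∪ᴴ-congˡ {F = F} (mk≅ V-≡ E-⇔) = mk≅ (cong (V F ∪_) V-≡) λ e → ⇔-refl ⊎-⇔ E-⇔ e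

  ∪ᴴ-assoc : (F ∪ᴴ G) ∪ᴴ H ≅ F ∪ᴴ (G ∪ᴴ H)
  ∪ᴴ-assoc {F = F} {G = G} {H = H} = mk≅ (∪-assoc (V F) (V G) (V H)) λ _ → mk⇔ assocʳ assocˡ

  ∪ᴴ-swap : F ∪ᴴ (G ∪ᴴ H) ≅ G ∪ᴴ (F ∪ᴴ H)
  ∪ᴴ-swap {F = F} {G = G} {H = H} = mk≅ V-≡ λ _ → mk⇔ swap swap
    where
      swap : ∀ {A B C : Set} → A ⊎ (B ⊎ C) → B ⊎ (A ⊎ C)
      swap = [ inj₂ ∘ inj₁ , [ inj₁ , inj₂ ∘ inj₂ ] ]
      open ≡-Reasoning
      V-≡ : V F ∪ (V G ∪ V H) ≡ V G ∪ (V F ∪ V H)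
      V-≡ = begin
        V F ∪ (V G ∪ V H)  ≡⟨ ∪-assoc (V F) (V G) (V H) ⟨
        (V F ∪ V G) ∪ V H  ≡⟨ cong (_∪ V H) (∪-comm (V F) (V G)) ⟩
        (V G ∪ V F) ∪ V H  ≡⟨ ∪-assoc (V G) (V F) (V H) ⟩
        V G ∪ (V F ∪ V H)  ∎

  ∪ᴴ-identityˡ : ∅ᴴ ∪ᴴ H ≅ H
  ∪ᴴ-identityˡ {H = H} = mk≅ (∪-identityˡ (V H)) λ _ → mk⇔ [ ⊥-elim , id ] inj₂

  ∪ᴴ-identityʳ : H ∪ᴴ ∅ᴴ ≅ H
  ∪ᴴ-identityʳ {H = H} = mk≅ (∪-identityʳ (V H)) λ _ → mk⇔ [ id , ⊥-elim ] inj₁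

  ⋃-resp-↭ : Fs ↭ Gs → ⋃ Fs ≅ ⋃ Gs
  ⋃-resp-↭ ↭.refl          = ≅-refl
  ⋃-resp-↭ (↭.prep _ p)    = ∪ᴴ-congˡ (⋃-resp-↭ p)
  ⋃-resp-↭ (↭.swap _ _ p)  = ≅-trans ∪ᴴ-swap (∪ᴴ-congˡ (∪ᴴ-congˡ (⋃-resp-↭ p)))
  ⋃-resp-↭ (↭.trans p p′)  = ≅-trans (⋃-resp-↭ p) (⋃-resp-↭ p′)

  induced-resp-≅ : G ≅ H → Induced J G → Induced J H
  induced-resp-≅ {J = J} (mk≅ V-≡ E-⇔) (VJ⊆VG , J⇔) =
    subst (V J ⊆_) V-≡ VJ⊆VG , λ e → ⇔-trans (J⇔ e) (E-⇔ e ×-⇔ ⇔-refl)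

  shared : Hypergraph n → Hypergraph n → Subset n
  shared F P = V F ∩ V P

  attachment-small-or-edge : Attaches (V P) (E P) F →
    ∣ shared F P ∣ ≤ 1 ⊎ (E F (shared F P) × E P (shared F P))
  attachment-small-or-edge (inj₁ empty) =
    inj₁ (≤-trans (≤-reflexive (trans (cong ∣_∣ (Empty-unique empty)) (∣⊥∣≡0 n))) z≤n)
  attachment-small-or-edge (inj₂ (inj₁ single)) = inj₁ (≤-reflexive single)
  attachment-small-or-edge (inj₂ (inj₂ shared)) = inj₂ shared

  attached-edge : 1 < k → Uniform k F → Attaches (V P) (E P) F →
    ∣ e ∣ ≡ k → e ⊆ shared F P → E F e × E P e
  attached-edge {F = F} {P = P} {e = e} 1<k F-uniform att ∣e∣≡k e⊆S
    with attachment-small-or-edge {P = P} {F = F} att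
  ... | inj₁ ∣S∣≤1 =
    contradiction (≤-trans (p⊆q⇒∣p∣≤∣q∣ e⊆S) ∣S∣≤1) (<⇒≱ (subst (1 <_) (sym ∣e∣≡k) 1<k))
  ... | inj₂ (F∋S , P∋S) =
    subst (λ s → E F s × E P s) (sym e≡S) (F∋S , P∋S)
    where
      e≡S : e ≡ shared F P
      e≡S = p⊆q∧∣p∣≡∣q∣⇒p≡q e⊆S (trans ∣e∣≡k (sym (F-uniform _ F∋S)))

  ∪ᴴ-linearUniform : LinearUniform k P → LinearUniform k F → Attaches (V P) (E P) F →
    LinearUniform k (P ∪ᴴ F)
  ∪ᴴ-linearUniform {P = P} {F = F}
    (P-inV , P-uniform , P-linear) (F-inV , F-uniform , F-linear) att =
    inV , uniform , linear
    where
      S = shared F P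

      inV : EdgesInV (P ∪ᴴ F)
      inV e (inj₁ P∋e) x∈e = p⊆p∪q (V F) (P-inV e P∋e x∈e)
      inV e (inj₂ F∋e) x∈e = q⊆p∪q (V P) (V F) (F-inV e F∋e x∈e)

      uniform : Uniform _ (P ∪ᴴ F)
      uniform e = [ P-uniform e , F-uniform e ]

      across : ∀ e f → E P e → E F f → e ≢ f → ∣ e ∩ f ∣ ≤ 1
      across e f P∋e F∋f e≢f with attachment-small-or-edge {P = P} {F = F} att
      ... | inj₁ ∣S∣≤1 = ≤-trans (p⊆q⇒∣p∣≤∣q∣ e∩f⊆S) ∣S∣≤1
        where
          e∩f⊆S : e ∩ f ⊆ S
          e∩f⊆S x∈e∩f = let x∈e , x∈f = x∈p∩q⁻ e f x∈e∩f in
            x∈p∩q⁺ (F-inV f F∋f x∈f , P-inV e P∋e x∈e)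
      ... | inj₂ (F∋S , P∋S) with ≡-dec Bool._≟_ f S
      ...   | yes refl = P-linear e f P∋e P∋S e≢f
      ...   | no f≢S = ≤-trans (p⊆q⇒∣p∣≤∣q∣ e∩f⊆f∩S) (F-linear f S F∋f F∋S f≢S)
        where
          e∩f⊆f∩S : e ∩ f ⊆ f ∩ S
          e∩f⊆f∩S x∈e∩f = let x∈e , x∈f = x∈p∩q⁻ e f x∈e∩f in
            x∈p∩q⁺ (x∈f , x∈p∩q⁺ (F-inV f F∋f x∈f , P-inV e P∋e x∈e))

      linear : Linear (P ∪ᴴ F)
      linear e f (inj₁ P∋e) (inj₁ P∋f) = P-linear e f P∋e P∋f
      linear e f (inj₂ F∋e) (inj₂ F∋f) = F-linear e f F∋e F∋f
      linear e f (inj₁ P∋e) (inj₂ F∋f) = across e f P∋e F∋f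
      linear e f (inj₂ F∋e) (inj₁ P∋f) e≢f =
        subst (_≤ 1) (cong ∣_∣ (∩-comm f e)) (across f e P∋f F∋e (e≢f ∘ sym))

  deleting-attachment-disconnects : EdgesInV P → EdgesInV F → Induced J (P ∪ᴴ F) →
    x ∈ V J → x ∉ V P → y ∈ V J → y ∉ V F → ¬ Connected (delete J (shared F P ∩ V J))
  deleting-attachment-disconnects {P = P} {F = F} {J = J} {x = x} {y = y}
    P-inV F-inV (VJ⊆V , J⇔) x∈J x∉P y∈J y∉F connected
    with connected Y (p∩q⊆p _ _) (y , y∈Y) (x , x∈rest)
    where
      cut = shared F P ∩ V J
      Y = (V J ─ cut) ∩ V P
      cut⊆VF : cut ⊆ V F
      cut⊆VF x∈cut = proj₁ (x∈p∩q⁻ _ _ (p∩q⊆p _ _ x∈cut))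
      cut⊆VP : cut ⊆ V P
      cut⊆VP x∈cut = proj₂ (x∈p∩q⁻ _ _ (p∩q⊆p _ _ x∈cut))
      y∈P : y ∈ V P
      y∈P = [ id , (λ y∈F → ⊥-elim (y∉F y∈F)) ] (x∈p∪q⁻ (V P) (V F) (VJ⊆V y∈J))
      y∈Y : y ∈ Y
      y∈Y = x∈p∩q⁺ (x∈p∧x∉q⇒x∈p─q y∈J (y∉F ∘ cut⊆VF) , y∈P)
      x∈rest : x ∈ (V J ─ cut) ─ Y
      x∈rest = x∈p∧x∉q⇒x∈p─q (x∈p∧x∉q⇒x∈p─q x∈J (x∉P ∘ cut⊆VP)) (x∉P ∘ proj₂ ∘ x∈p∩q⁻ _ _)
  ... | e , (J∋e , e-misses-cut) , (u , u∈e∩Y) , (w , w∈e∩rest) with to (J⇔ e) J∋e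
  ...   | inj₁ P∋e , _ = w∉Y (x∈p∩q⁺ (w∈J─cut , P-inV e P∋e w∈e))
    where
      w∈e = proj₁ (x∈p∩q⁻ e _ w∈e∩rest)
      w∈J─cut = p─q⊆p _ _ (proj₂ (x∈p∩q⁻ e _ w∈e∩rest))
      w∉Y = x∈p─q⇒x∉q _ _ (proj₂ (x∈p∩q⁻ e _ w∈e∩rest))
  ...   | inj₂ F∋e , _ = e-misses-cut (u , x∈p∩q⁺ (u∈e , u∈cut))
    where
      u∈e = proj₁ (x∈p∩q⁻ e _ u∈e∩Y)
      u∈Y = proj₂ (x∈p∩q⁻ e _ u∈e∩Y)
      u∈cut = x∈p∩q⁺ (x∈p∩q⁺ (F-inV e F∋e u∈e , proj₂ (x∈p∩q⁻ _ _ u∈Y)) ,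
                    p─q⊆p _ _ (proj₁ (x∈p∩q⁻ _ _ u∈Y)))

  attachment-cut-connected : Inseparable k J → LinearUniform k P → LinearUniform k F →
    Attaches (V P) (E P) F → Induced J (P ∪ᴴ F) → Connected (delete J (shared F P ∩ V J))
  attachment-cut-connected {J = J} {P = P} {F = F}
    ins@(_ , _ , minus-independent-connected , minus-edge-connected) P-lu F-lu att J-ind@(_ , J⇔)
    with attachment-small-or-edge {P = P} {F = F} att
  ... | inj₁ ∣S∣≤1 =
    minus-independent-connected cut (p∩q⊆q (shared F P) (V J))
      (≤-<-trans ∣cut∣≤1 (inseparable⇒1<k ins))
      (independent-of-size≤1 {H = J} ∣cut∣≤1)
    where
      cut = shared F P ∩ V J
      ∣cut∣≤1 : ∣ cut ∣ ≤ 1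
      ∣cut∣≤1 = ≤-trans (∣p∩q∣≤∣p∣ (shared F P) (V J)) ∣S∣≤1
  ... | inj₂ (F∋S , P∋S) with shared F P ⊆? V J
  ...   | yes S⊆VJ =
    subst (Connected ∘ delete J) (sym (p⊆q⇒p∩q≡p S⊆VJ))
      (minus-edge-connected _ (from (J⇔ _) (inj₁ P∋S , S⊆VJ)))
  ...   | no S⊈VJ =
    minus-independent-connected cut (p∩q⊆q (shared F P) (V J)) ∣cut∣<k
      (independent-in-edge P∪F-linear J-ind (inj₁ P∋S) S⊈VJ (p∩q⊆p _ _))
    where
      S = shared F P
      cut = S ∩ V J
      P∪F-linear = proj₂ (proj₂ (∪ᴴ-linearUniform P-lu F-lu att))
      cut⊂S : cut ⊂ S
      cut⊂S = let x , x∈S , x∉J = ⊈-witness S (V J) S⊈VJ in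
        p∩q⊆p S (V J) , x , x∈S , x∉J ∘ proj₂ ∘ x∈p∩q⁻ S (V J)
      ∣cut∣<k : ∣ cut ∣ < _
      ∣cut∣<k = <-≤-trans (p⊂q⇒∣p∣<∣q∣ cut⊂S) (≤-reflexive (proj₁ (proj₂ F-lu) S F∋S))

  ∪ᴴ-edge-restrictˡ : 1 < k → LinearUniform k F → Attaches (V P) (E P) F →
    E (P ∪ᴴ F) e → e ⊆ V P → E P e
  ∪ᴴ-edge-restrictˡ _ _ _ (inj₁ P∋e) _ = P∋e
  ∪ᴴ-edge-restrictˡ {F = F} {P = P} 1<k (F-inV , F-uniform , _) att (inj₂ F∋e) e⊆VP =
    proj₂ (attached-edge {F = F} {P = P} 1<k F-uniform att (F-uniform _ F∋e)
      λ x∈e → x∈p∩q⁺ (F-inV _ F∋e x∈e , e⊆VP x∈e))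

  ∪ᴴ-edge-restrictʳ : 1 < k → LinearUniform k P → LinearUniform k F → Attaches (V P) (E P) F →
    E (P ∪ᴴ F) e → e ⊆ V F → E F e
  ∪ᴴ-edge-restrictʳ _ _ _ _ (inj₂ F∋e) _ = F∋e
  ∪ᴴ-edge-restrictʳ {P = P} {F = F}
    1<k (P-inV , P-uniform , _) (_ , F-uniform , _) att (inj₁ P∋e) e⊆VF =
    proj₁ (attached-edge {F = F} {P = P} 1<k F-uniform att (P-uniform _ P∋e)
      λ x∈e → x∈p∩q⁺ (e⊆VF x∈e , P-inV _ P∋e x∈e))

  induced-∪ᴴ : Inseparable k J → LinearUniform k P → LinearUniform k F →
    Attaches (V P) (E P) F → Induced J (P ∪ᴴ F) → Induced J P ⊎ Induced J F
  induced-∪ᴴ {J = J} {P = P} {F = F} ins P-lu F-lu att J-ind with V J ⊆? V P | V J ⊆? V F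
  ... | yes VJ⊆VP | _ = inj₁ (induced-restrict J-ind VJ⊆VP (λ _ → inj₁)
          λ _ P∪F∋e e⊆VJ → ∪ᴴ-edge-restrictˡ {F = F} {P = P}
            (inseparable⇒1<k ins) F-lu att P∪F∋e (⊆-trans e⊆VJ VJ⊆VP))
  ... | no _ | yes VJ⊆VF = inj₂ (induced-restrict J-ind VJ⊆VF (λ _ → inj₂)
          λ _ P∪F∋e e⊆VJ → ∪ᴴ-edge-restrictʳ {P = P} {F = F}
            (inseparable⇒1<k ins) P-lu F-lu att P∪F∋e (⊆-trans e⊆VJ VJ⊆VF))
  ... | no VJ⊈VP | no VJ⊈VF =
    let x , x∈J , x∉P = ⊈-witness (V J) (V P) VJ⊈VP
        y , y∈J , y∉F = ⊈-witness (V J) (V F) VJ⊈VF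
    in ⊥-elim (deleting-attachment-disconnects (proj₁ P-lu) (proj₁ F-lu) J-ind x∈J x∉P y∈J y∉F
                 (attachment-cut-connected ins P-lu F-lu att J-ind))

  induced-∪ᴴ-⋃ : Inseparable k J → LinearUniform k P → (∀ G → G L.∈ Gs → LinearUniform k G) →
    OrderedForestFrom (V P) (E P) Gs → Induced J (P ∪ᴴ ⋃ Gs) →
    Induced J P ⊎ ∃ λ G → G L.∈ Gs × Induced J G
  induced-∪ᴴ-⋃ {Gs = []} _ _ _ _ J-ind = inj₁ (induced-resp-≅ ∪ᴴ-identityʳ J-ind)
  induced-∪ᴴ-⋃ {Gs = G ∷ Gs} ins P-lu Gs-lu (lift att , Gs-attached) J-ind
    with induced-∪ᴴ-⋃ ins (∪ᴴ-linearUniform P-lu G-lu att) (λ G′ → Gs-lu G′ ∘ there) Gs-attached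
           (induced-resp-≅ (≅-sym ∪ᴴ-assoc) J-ind)
    where
      G-lu = Gs-lu G (here refl)
  ... | inj₂ (G′ , G′∈Gs , J-ind-G′) = inj₂ (G′ , there G′∈Gs , J-ind-G′)
  ... | inj₁ J-ind-P∪G =
    map₂ (λ J-ind-G → G , here refl , J-ind-G)
      (induced-∪ᴴ ins P-lu (Gs-lu G (here refl)) att J-ind-P∪G)

lemma3p3 : {n : ℕ} (k : ℕ) (Fs : List (Hypergraph n)) (J : Hypergraph n) →
    IsForest k Fs → Induced J (⋃ Fs) → Inseparable k J →
    ∃ λ F → F L.∈ Fs × Induced J F
lemma3p3 k Fs J (Fs-lu , Gs , Gs↭Fs , Gs-attached) J-ind ins
  with induced-∪ᴴ-⋃ ins ∅ᴴ-linearUniform (λ G → Fs-lu G ∘ ∈-resp-↭ Gs↭Fs) Gs-attached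
         (induced-resp-≅ (≅-trans (⋃-resp-↭ (↭-sym Gs↭Fs)) (≅-sym ∪ᴴ-identityˡ)) J-ind)
... | inj₁ J-ind-∅ = let (_ , (_ , _ , _ , J∋e , _) , _) = ins in ⊥-elim (¬induced-∅ᴴ J∋e J-ind-∅)
... | inj₂ (G , G∈Gs , J-ind-G) = G , ∈-resp-↭ Gs↭Fs G∈Gs , J-ind-G
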